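{- Let $G$ be a finite simple connected graph with a closed labeling $V(G)=[n]$, and let $N<\mathrm{diam}(G)$. Let $a_M=|L_M|$ for each $M$, and let $S_N=(b_1,\dots,b_{a_N})$, where $b_s$ is the number of edges of $G$ joining the $s$-th smallest element of $L_N$ to a vertex of $L_{N+1}$. Then (1) $b_{a_N}=a_{N+1}$, and (2) $S_N$ is increasing: $b_s\le b_{s+1}$ for $s=1,\dots,a_N-1$.
   Context: A labeling $V(G)=[n]$ is closed if whenever $\{j,i\},\{i,k\}\in E(G)$ with $j\neq k$ and either $j>i<k$ or $j<i>k$, then $\{j,k\}\in E(G)$. For a connected graph with $V(G)=[n]$, the $N$-th layer is $L_N=\{i\in[n]: \text{the graph distance from } i \text{ to } 1 \text{ is } N\}$. -}

module Defs where

open import Data.Nat using (ℕ; zero; suc; _<_)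
open import Data.Fin using (Fin; toℕ) renaming (_≟_ to _≟F_)
open import Data.Bool using (Bool; true; false; _∧_; _∨_; not; if_then_else_)
open import Data.List using (List; []; _∷_; map; length; filterᵇ; allFin)
open import Data.Bool.ListAction using (any)
open import Data.Product using (Σ; ∃; _×_)
open import Relation.Binary.PropositionalEquality using (_≡_; _≢_)
open import Relation.Nullary.Decidable using (⌊_⌋)

-- A finite simple graph on the vertex set Fin n (vertex i stands for label toℕ i + 1).
-- Edges are given by a Boolean adjacency relation, symmetric and irreflexive.
record Graph (n : ℕ) : Set where
  field
    adj    : Fin n → Fin n → Bool
    sym    : ∀ i j → adj i j ≡ adj j i
    irrefl : ∀ i → adj i i ≡ false
open Graph public

Edge : ∀ {n} → Graph n → Fin n → Fin n → Set
Edge G i j = adj G i j ≡ true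

ClosedLabeling : ∀ {n} → Graph n → Set
ClosedLabeling {n} G =
  ∀ (i j k : Fin n) → Edge G j i → Edge G i k → j ≢ k →
    ((toℕ i < toℕ j × toℕ i < toℕ k) Data.Sum.⊎ (toℕ j < toℕ i × toℕ k < toℕ i)) →
    Edge G j k
  where import Data.Sum

within : ∀ {n} → Graph n → ℕ → Fin n → Fin n → Bool
within {n} G zero    u v = ⌊ u ≟F v ⌋
within {n} G (suc k) u v =
  within G k u v ∨ any (λ w → within G k u w ∧ adj G w v) (allFin n)

isDist : ∀ {n} → Graph n → Fin n → Fin n → ℕ → Bool
isDist G u v zero    = within G zero u v
isDist G u v (suc d) = within G (suc d) u v ∧ not (within G d u v)

Connected : ∀ {n} → Graph n → Set
Connected {n} G = ∀ (u v : Fin n) → ∃ λ k → within G k u v ≡ true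

LtDiam : ∀ {n} → ℕ → Graph n → Set
LtDiam {n} N G = Σ (Fin n) λ u → Σ (Fin n) λ v → Σ ℕ λ d →
  (isDist G u v d ≡ true) × (N < d)

inLayer : ∀ {n} → Graph (suc n) → ℕ → Fin (suc n) → Bool
inLayer G N i = isDist G Data.Fin.zero i N

layer : ∀ {n} → Graph (suc n) → ℕ → List (Fin (suc n))
layer {n} G N = filterᵇ (inLayer G N) (allFin (suc n))

layerSize : ∀ {n} → Graph (suc n) → ℕ → ℕ
layerSize G M = length (layer G M)

edgesToNext : ∀ {n} → Graph (suc n) → ℕ → Fin (suc n) → ℕ
edgesToNext {n} G N v =
  length (filterᵇ (λ w → adj G v w ∧ inLayer G (suc N) w) (allFin (suc n)))

seqS : ∀ {n} → Graph (suc n) → ℕ → List ℕ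
seqS G N = map (edgesToNext G N) (layer G N)

-- In a closed labeling every geodesic is monotone in the labels: an interior
-- local extremum y between its neighbours x and y′ would, by closedness, make x
-- adjacent to y′ and shorten the geodesic. Walking a geodesic from c down to a
-- then shows that an edge {a, b} with a < c < b forces c to be adjacent to both
-- a and b. Two consequences drive the theorem. First, the distance from vertex 1
-- is monotone in the label, so L_N lies entirely below L_(N+1); hence a
-- neighbour w ∈ L_(N+1) of u ∈ L_N is a neighbour of every larger v ∈ L_N
-- (u < v < w), which gives (2), and the largest vertex of L_N is adjacent to all
-- of L_(N+1), since each w ∈ L_(N+1) has a neighbour in L_N, which gives (1).
-- Second, dist(u, v) ≤ dist(1, u) whenever v ≤ u, so vertex 1 has maximal
-- eccentricity and L_N is nonempty for N < diam(G).

module Submission where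

open import Defs hiding (sym)
open import Data.Bool using (Bool; true; false; T; not; _∧_)
open import Data.Bool.Properties using (T-∨; T-∧; T-≡)
open import Data.Fin using (Fin; zero)
open import Data.Fin.Properties
  using (_≟_; _≤?_; ≤-refl; ≤-reflexive; ≤-antisym; ≤-total; <-trans; <-cmp; <⇒≢; ≤∧≢⇒<)
open import Data.List using (List; []; _∷_; map; last; allFin; length)
open import Data.List.Membership.Propositional using (_∈_; lose)
open import Data.List.Membership.Propositional.Properties using (∈-allFin; ∈-filter⁺)
open import Data.List.Properties using (last-map; filter-≐)
open import Data.List.Relation.Unary.All using (All; _∷_)
import Data.List.Relation.Unary.All as All
open import Data.List.Relation.Unary.All.Properties using (all-filter; last⁺)
open import Data.List.Relation.Unary.AllPairs using (AllPairs; []; _∷_)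
import Data.List.Relation.Unary.AllPairs.Properties as AllPairs
open import Data.List.Relation.Unary.Any using (here; there; satisfied)
open import Data.List.Relation.Unary.Any.Properties using (any⁺; any⁻)
open import Data.List.Relation.Unary.Linked using (Linked; []; [-]; _∷_)
open import Data.List.Relation.Unary.Linked.Properties using (AllPairs⇒Linked)
open import Data.List.Relation.Binary.Sublist.Propositional using (⊆-refl)
open import Data.List.Relation.Binary.Sublist.Propositional.Properties
  using (length-mono-≤) renaming (filter⁺ to filter-⊆⁺)
open import Data.Maybe using (just)
import Data.Maybe as Maybe
open import Data.Maybe.Relation.Unary.All using (drop-just)
import Data.Maybe.Relation.Unary.All as MaybeAll
open import Data.Nat using (ℕ; zero; suc; z≤n; s≤s)
import Data.Nat as ℕ
import Data.Nat.Properties as ℕ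
open import Data.Product using (∃; _×_; _,_; proj₁; proj₂)
open import Data.Sum using (_⊎_; inj₁; inj₂; [_,_])
open import Function using (_∘_; id)
open import Function.Bundles using (Equivalence)
open import Relation.Binary.Definitions using (tri<; tri≈; tri>)
open import Relation.Binary.PropositionalEquality
  using (_≡_; _≢_; refl; sym; trans; cong; subst; module ≡-Reasoning)
open import Relation.Nullary using (¬_; yes; no; contradiction)
open import Relation.Nullary.Decidable using (T?; toWitness; fromWitness)

private
  open Equivalence

  ¬T⇒T-not : ∀ {b} → ¬ T b → T (not b)
  ¬T⇒T-not {false} _  = _
  ¬T⇒T-not {true}  ¬t = ¬t _

  T-not⇒¬T : ∀ {b} → T (not b) → ¬ T b
  T-not⇒¬T {false} _ ()

module _ {n : ℕ} where

  open Data.Fin using (_≤_; _<_)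

  private variable
    s t v w x y y′ z : Fin n

  Toward : Fin n → Fin n → Fin n → Set
  Toward x y z = (x < z → x < y × y ≤ z) × (z < x → z ≤ y × y < x)

  LocalExtremum : Fin n → Fin n → Fin n → Set
  LocalExtremum x y z = (y < x × y < z) ⊎ (x < y × z < y)

  Between : Fin n → Fin n → Fin n → Set
  Between s v t = (s ≤ v × v ≤ t) ⊎ (t ≤ v × v ≤ s)

  toward-end : ∀ x z → Toward x z z
  toward-end x z = (λ x<z → x<z , ≤-refl) , (λ z<x → ≤-refl , z<x)

  toward-step : x ≢ y → ¬ LocalExtremum x y y′ → Toward y y′ z → Toward x y z
  toward-step {x} {y} {y′} {z} x≢y ¬extremum (up , down) = forward , backward
    where
    forward : x < z → x < y × y ≤ z
    forward x<z with <-cmp x y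
    ... | tri≈ _ x≡y _ = contradiction x≡y x≢y
    ... | tri> _ _ y<x = contradiction (inj₁ (y<x , proj₁ (up (<-trans y<x x<z)))) ¬extremum
    ... | tri< x<y _ _ = x<y , ℕ.≮⇒≥ (λ z<y → ¬extremum (inj₂ (x<y , proj₂ (down z<y))))

    backward : z < x → z ≤ y × y < x
    backward z<x with <-cmp x y
    ... | tri≈ _ x≡y _ = contradiction x≡y x≢y
    ... | tri< x<y _ _ = contradiction (inj₂ (x<y , proj₂ (down (<-trans z<x x<y)))) ¬extremum
    ... | tri> _ _ y<x = ℕ.≮⇒≥ (λ y<z → ¬extremum (inj₁ (y<x , proj₁ (up y<z)))) , y<x

  between-self : Between s v s → v ≡ s
  between-self (inj₁ (s≤v , v≤s)) = ≤-antisym v≤s s≤v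
  between-self (inj₂ (s≤v , v≤s)) = ≤-antisym v≤s s≤v

  between-split : Between s v t → ∀ w →
                  Between s v w ⊎ v ≡ t ⊎ (w < v × v < t) ⊎ (t < v × v < w)
  between-split {v = v} {t} (inj₁ (s≤v , v≤t)) w with v ≤? w | v ≟ t
  ... | yes v≤w | _       = inj₁ (inj₁ (s≤v , v≤w))
  ... | no _    | yes v≡t = inj₂ (inj₁ v≡t)
  ... | no v≰w  | no v≢t  = inj₂ (inj₂ (inj₁ (ℕ.≰⇒> v≰w , ≤∧≢⇒< v≤t v≢t)))
  between-split {v = v} {t} (inj₂ (t≤v , v≤s)) w with w ≤? v | v ≟ t
  ... | yes w≤v | _       = inj₁ (inj₂ (w≤v , v≤s))
  ... | no _    | yes v≡t = inj₂ (inj₁ v≡t)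
  ... | no w≰v  | no v≢t  = inj₂ (inj₂ (inj₂ (≤∧≢⇒< t≤v (v≢t ∘ sym) , ℕ.≰⇒> w≰v)))

module _ {A : Set} where

  private variable
    m x : A
    xs : List A
    R : A → A → Set

  last-nonempty : x ∈ xs → ∃ λ m → last xs ≡ just m
  last-nonempty {xs = _ ∷ []}     _ = _ , refl
  last-nonempty {xs = _ ∷ y ∷ ys} _ = last-nonempty {xs = y ∷ ys} (here refl)

  last-maximum : AllPairs R xs → last xs ≡ just m → x ∈ xs → x ≡ m ⊎ R x m
  last-maximum {xs = _ ∷ []}    _         refl   (here refl) = inj₁ refl
  last-maximum {xs = _ ∷ _ ∷ _} (rs ∷ _)  last≡m (here refl) =
    inj₂ (drop-just (subst (MaybeAll.All _) last≡m (last⁺ rs)))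
  last-maximum {xs = _ ∷ _ ∷ _} (_ ∷ rss) last≡m (there x∈)  = last-maximum rss last≡m x∈

  map-linked : ∀ {B : Set} {P : A → Set} {S : B → B → Set} (f : A → B) →
               (∀ {x y} → P x → P y → R x y → S (f x) (f y)) →
               All P xs → Linked R xs → Linked S (map f xs)
  map-linked f mono _                []       = []
  map-linked f mono _                [-]      = [-]
  map-linked f mono (px ∷ py ∷ pxs) (r ∷ rs) = mono px py r ∷ map-linked f mono (py ∷ pxs) rs

module Walks {n : ℕ} (G : Graph n) where

  -- Records rather than T (within G k u v) and T (isDist G u v k), so that the
  -- indices can be inferred: neither T nor within is injective.
  record Reach (k : ℕ) (u v : Fin n) : Set where
    constructor reach
    field reached : T (within G k u v)

  record Dist (k : ℕ) (u v : Fin n) : Set where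
    constructor dist
    field exact : T (isDist G u v k)

  open Reach
  open Dist

  private variable
    j k : ℕ
    u v w : Fin n

  edge-sym : Edge G u v → Edge G v u
  edge-sym {u} {v} e = trans (Graph.sym G v u) e

  edge⇒≢ : Edge G u v → u ≢ v
  edge⇒≢ {u} e refl with trans (sym e) (irrefl G u)
  ... | ()

  reach-refl : ∀ k u → Reach k u u
  reach-refl zero    u = reach (fromWitness refl)
  reach-refl (suc k) u = reach (from T-∨ (inj₁ (reached (reach-refl k u))))

  reach-zero⁻ : Reach 0 u v → u ≡ v
  reach-zero⁻ (reach r) = toWitness r

  reach-suc : Reach k u v → Reach (suc k) u v
  reach-suc (reach r) = reach (from T-∨ (inj₁ r))

  reach-snoc : Reach k u w → Edge G w v → Reach (suc k) u v
  reach-snoc {w = w} (reach r) e =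
    reach (from T-∨ (inj₂ (any⁺ _ (lose (∈-allFin w) (from T-∧ (r , from T-≡ e))))))

  reach-suc⁻ : Reach (suc k) u v → Reach k u v ⊎ ∃ λ w → Reach k u w × Edge G w v
  reach-suc⁻ (reach r) with to T-∨ r
  ... | inj₁ r′ = inj₁ (reach r′)
  ... | inj₂ r′ with satisfied (any⁻ _ (allFin n) r′)
  ...   | w , p with to T-∧ p
  ...     | r″ , e = inj₂ (w , reach r″ , to T-≡ e)

  reach-cons : Edge G u w → Reach k w v → Reach (suc k) u v
  reach-cons {k = zero} e r with reach-zero⁻ r
  ... | refl = reach-snoc (reach-refl 0 _) e
  reach-cons {k = suc k} e r with reach-suc⁻ r
  ... | inj₁ r′           = reach-suc (reach-cons e r′)
  ... | inj₂ (_ , r′ , e′) = reach-snoc (reach-cons e r′) e′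

  reach-sym : Reach k u v → Reach k v u
  reach-sym {k = zero} r with reach-zero⁻ r
  ... | refl = r
  reach-sym {k = suc k} r with reach-suc⁻ r
  ... | inj₁ r′           = reach-suc (reach-sym r′)
  ... | inj₂ (_ , r′ , e) = reach-cons (edge-sym e) (reach-sym r′)

  reach-mono : j ℕ.≤ k → Reach j u v → Reach k u v
  reach-mono = go ∘ ℕ.≤⇒≤′
    where
    go : j ℕ.≤′ k → Reach j u v → Reach k u v
    go ℕ.≤′-refl       = id
    go (ℕ.≤′-step j≤k) = reach-suc ∘ go j≤k

  dist⇒reach : ∀ k → Dist k u v → Reach k u v
  dist⇒reach zero    (dist d) = reach d
  dist⇒reach (suc k) (dist d) = reach (proj₁ (to T-∧ d))

  dist⇒¬reach : Dist (suc k) u v → ¬ Reach k u v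
  dist⇒¬reach (dist d) (reach r) = T-not⇒¬T (proj₂ (to T-∧ d)) r

  reach⇒dist-suc : Reach (suc k) u v → ¬ Reach k u v → Dist (suc k) u v
  reach⇒dist-suc (reach r) ¬r = dist (from T-∧ (r , ¬T⇒T-not (¬r ∘ reach)))

  reach⇒dist : ∀ k → Reach k u v → ∃ λ j → Dist j u v
  reach⇒dist zero    (reach r) = 0 , dist r
  reach⇒dist {u} {v} (suc k) r with T? (within G k u v)
  ... | yes r′ = reach⇒dist k (reach r′)
  ... | no ¬r′ = suc k , reach⇒dist-suc r (¬r′ ∘ reached)

  connected⇒dist : Connected G → ∀ u v → ∃ λ j → Dist j u v
  connected⇒dist connected u v with connected u v
  ... | k , r = reach⇒dist k (reach (from T-≡ r))

  dist-≤ : Dist j u v → Reach k u v → j ℕ.≤ k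
  dist-≤ {zero}  _ _ = z≤n
  dist-≤ {suc j} d r = ℕ.≰⇒> (λ k≤j → dist⇒¬reach d (reach-mono k≤j r))

  dist-sym : ∀ k → Dist k u v → Dist k v u
  dist-sym zero    (dist d) = dist (reached (reach-sym {0} (reach d)))
  dist-sym (suc k) d =
    reach⇒dist-suc (reach-sym (dist⇒reach (suc k) d)) (dist⇒¬reach d ∘ reach-sym)

  dist-suc⁻ʳ : Dist (suc k) u v → ∃ λ w → Dist k u w × Edge G w v
  dist-suc⁻ʳ {k} d with reach-suc⁻ (dist⇒reach (suc k) d)
  ... | inj₁ r = contradiction r (dist⇒¬reach d)
  dist-suc⁻ʳ {zero}  d | inj₂ (w , reach r , e) = w , dist r , e
  dist-suc⁻ʳ {suc k} d | inj₂ (w , r , e) =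
    w , reach⇒dist-suc r (λ r′ → dist⇒¬reach d (reach-snoc r′ e)) , e

  dist-suc⁻ˡ : Dist (suc k) u v → ∃ λ w → Edge G u w × Dist k w v
  dist-suc⁻ˡ {k} d with dist-suc⁻ʳ (dist-sym (suc k) d)
  ... | w , dw , e = w , edge-sym e , dist-sym k dw

  dist-prefix : ∀ {j} k → Dist k u v → j ℕ.≤ k → ∃ (Dist j u)
  dist-prefix k d j≤k with ℕ.m≤n⇒m<n∨m≡n j≤k
  ... | inj₂ refl = _ , d
  ... | inj₁ (s≤s j≤k′) with dist-suc⁻ʳ d
  ...   | _ , d′ , _ = dist-prefix _ d′ j≤k′

module ClosedLabeled {n : ℕ} {G : Graph n} (closed : ClosedLabeling G) (connected : Connected G) where

  open Data.Fin using (_≤_; _<_)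
  open Walks G

  private variable
    k : ℕ
    a b c s t v x z : Fin n

  geodesic-toward : ∀ k → Dist (suc k) x z → ∃ λ y → Edge G x y × Dist k y z × Toward x y z
  geodesic-toward zero d with dist-suc⁻ˡ d
  ... | y , xy , dist r with reach-zero⁻ (reach r)
  ... | refl = y , xy , dist r , toward-end _ y
  geodesic-toward {x} (suc k) d with dist-suc⁻ˡ d
  ... | y , xy , dy with geodesic-toward k dy
  ... | y′ , yy′ , dy′ , toward = y , xy , dy , toward-step (edge⇒≢ xy) no-extremum toward
    where
    ry′ : Reach k y′ _
    ry′ = dist⇒reach k dy′

    x≢y′ : x ≢ y′
    x≢y′ refl = dist⇒¬reach d (reach-suc ry′)

    no-extremum : ¬ LocalExtremum x y y′
    no-extremum extremum = dist⇒¬reach d (reach-cons (closed y x y′ xy yy′ x≢y′ extremum) ry′)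

  private
    edge-to-upper-end : ∀ k → Dist k c a → Edge G a b → a < c → c < b → Edge G c b
    edge-to-upper-end zero (dist r) _ a<c _ = contradiction (sym (reach-zero⁻ (reach r))) (<⇒≢ a<c)
    edge-to-upper-end {a = a} (suc k) d ab a<c c<b with geodesic-toward k d
    ... | y , cy , dy , (_ , toward-a) with toward-a a<c
    ... | a≤y , y<c with y ≟ a
    ... | yes refl = closed y _ _ cy ab (<⇒≢ c<b) (inj₁ (a<c , <-trans a<c c<b))
    ... | no y≢a   = closed y _ _ cy yb (<⇒≢ c<b) (inj₁ (y<c , <-trans y<c c<b))
      where
      yb = edge-to-upper-end k dy ab (≤∧≢⇒< a≤y (y≢a ∘ sym)) (<-trans y<c c<b)

  between-adjacent : Edge G a b → a < c → c < b → Edge G c a × Edge G c b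
  between-adjacent {a} {b} {c} ab a<c c<b with connected⇒dist connected c a
  ... | k , d = closed b c a cb (edge-sym ab) (<⇒≢ a<c ∘ sym) (inj₂ (c<b , <-trans a<c c<b)) , cb
    where
    cb : Edge G c b
    cb = edge-to-upper-end k d ab a<c c<b

  reach-between : ∀ k → Reach k s t → Between s v t → Reach k s v
  reach-between zero r between with reach-zero⁻ r
  ... | refl with between-self between
  ...   | refl = r
  reach-between (suc k) r between with reach-suc⁻ r
  ... | inj₁ r′ = reach-suc (reach-between k r′ between)
  ... | inj₂ (w , r′ , wt) with between-split between w
  ... | inj₁ between′                 = reach-suc (reach-between k r′ between′)
  ... | inj₂ (inj₁ refl)               = r
  ... | inj₂ (inj₂ (inj₁ (w<v , v<t))) =
    reach-snoc r′ (edge-sym (proj₁ (between-adjacent wt w<v v<t)))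
  ... | inj₂ (inj₂ (inj₂ (t<v , v<w))) =
    reach-snoc r′ (edge-sym (proj₂ (between-adjacent (edge-sym wt) t<v v<w)))

module Layers {n : ℕ} {G : Graph (suc n)} (closed : ClosedLabeling G) (connected : Connected G) where

  open Data.Fin using (_≤_; _<_)
  open Walks G
  open ClosedLabeled closed connected

  InLayer : ℕ → Fin (suc n) → Set
  InLayer N = Dist N zero

  in-layer : ∀ N {v} → T (inLayer G N v) → InLayer N v
  in-layer N = dist

  private variable
    N d : ℕ
    m u v w : Fin (suc n)

  layer-< : InLayer N v → InLayer (suc N) w → v < w
  layer-< {N} v∈ w∈ = ℕ.≰⇒> λ w≤v →
    dist⇒¬reach w∈ (reach-between N (dist⇒reach N v∈) (inj₁ (z≤n , w≤v)))

  layer-edge-mono : Edge G u w → u < v → InLayer N v → InLayer (suc N) w → Edge G v w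
  layer-edge-mono uw u<v v∈ w∈ = proj₂ (between-adjacent uw u<v (layer-< v∈ w∈))

  max-adjacent : InLayer N m → (∀ x → InLayer N x → x ≤ m) → InLayer (suc N) w → Edge G m w
  max-adjacent {m = m} m∈ maximal w∈ with dist-suc⁻ʳ w∈
  ... | x , x∈ , xw with x ≟ m
  ... | yes refl = xw
  ... | no x≢m   = layer-edge-mono xw (≤∧≢⇒< (maximal x x∈) x≢m) m∈ w∈

  far-from-root : v ≤ u → Dist d u v → ∃ λ j → ∃ (Dist j zero) × d ℕ.≤ j
  far-from-root {u = u} v≤u duv with connected⇒dist connected zero u
  ... | j , dj =
    j , (u , dj) , dist-≤ duv (reach-between j (reach-sym (dist⇒reach j dj)) (inj₂ (z≤n , v≤u)))

  root-eccentricity : Dist d u v → ∃ λ j → ∃ (Dist j zero) × d ℕ.≤ j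
  root-eccentricity {u = u} {v} duv with ≤-total v u
  ... | inj₁ v≤u = far-from-root v≤u duv
  ... | inj₂ u≤v = far-from-root u≤v (dist-sym _ duv)

  layer-nonempty : LtDiam N G → ∃ (InLayer N)
  layer-nonempty (u , v , d , duv , N<d) with root-eccentricity (dist (from T-≡ duv))
  ... | j , (_ , dj) , d≤j = dist-prefix j dj (ℕ.≤-trans (ℕ.<⇒≤ N<d) d≤j)

  layer-all : ∀ N → All (InLayer N) (layer G N)
  layer-all N = All.map (in-layer N) (all-filter (T? ∘ inLayer G N) (allFin _))

  ∈-layer : InLayer N v → v ∈ layer G N
  ∈-layer {N} {v} v∈ = ∈-filter⁺ (T? ∘ inLayer G N) (∈-allFin v) (Dist.exact v∈)

  layer-sorted : ∀ N → AllPairs _<_ (layer G N)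
  layer-sorted N = AllPairs.filter⁺ (T? ∘ inLayer G N) (AllPairs.tabulate⁺-< id)

  last-layer : LtDiam N G →
               ∃ λ m → last (layer G N) ≡ just m × InLayer N m × (∀ x → InLayer N x → x ≤ m)
  last-layer {N} ltDiam with layer-nonempty ltDiam
  ... | v , v∈ with last-nonempty (∈-layer v∈)
  ... | m , last≡m =
    m , last≡m , drop-just (subst (MaybeAll.All _) last≡m (last⁺ (layer-all N))) , maximal
    where
    maximal : ∀ x → InLayer N x → x ≤ m
    maximal x x∈ = [ ≤-reflexive , ℕ.<⇒≤ ] (last-maximum (layer-sorted N) last≡m (∈-layer x∈))

  toNext : ℕ → Fin (suc n) → Fin (suc n) → Bool
  toNext N v w = adj G v w ∧ inLayer G (suc N) w

  toNext⁺ : Edge G v w → InLayer (suc N) w → T (toNext N v w)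
  toNext⁺ vw w∈ = from T-∧ (from T-≡ vw , Dist.exact w∈)

  toNext⁻ : T (toNext N v w) → Edge G v w × InLayer (suc N) w
  toNext⁻ {N = N} p with to T-∧ p
  ... | vw , w∈ = to T-≡ vw , in-layer (suc N) w∈

  edgesToNext-mono : u < v → InLayer N v → edgesToNext G N u ℕ.≤ edgesToNext G N v
  edgesToNext-mono {u} {v} {N} u<v v∈ =
    length-mono-≤ (filter-⊆⁺ (T? ∘ toNext N u) (T? ∘ toNext N v) step (⊆-refl {x = allFin _}))
    where
    step : ∀ {w w′} → w ≡ w′ → T (toNext N u w) → T (toNext N v w′)
    step refl p with toNext⁻ p
    ... | uw , w∈ = toNext⁺ (layer-edge-mono uw u<v v∈ w∈) w∈

  edgesToNext-max : InLayer N m → (∀ x → InLayer N x → x ≤ m) →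
                    edgesToNext G N m ≡ layerSize G (suc N)
  edgesToNext-max {N} {m} m∈ maximal =
    cong length (filter-≐ (T? ∘ toNext N m) (T? ∘ inLayer G (suc N)) (to-next , from-next)
                          (allFin _))
    where
    to-next : ∀ {w} → T (toNext N m w) → T (inLayer G (suc N) w)
    to-next = Dist.exact ∘ proj₂ ∘ toNext⁻ {N = N}

    from-next : ∀ {w} → T (inLayer G (suc N) w) → T (toNext N m w)
    from-next w∈ = toNext⁺ (max-adjacent m∈ maximal (in-layer (suc N) w∈)) (in-layer (suc N) w∈)

open import Data.Nat using (_≤_)

proposition5p3 : (n : ℕ) (G : Graph (suc n)) → Connected G → ClosedLabeling G →
    (N : ℕ) → LtDiam N G →
    (last (seqS G N) ≡ just (layerSize G (suc N))) × Linked _≤_ (seqS G N)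
proposition5p3 n G connected closed N ltDiam = last-edges , sorted-edges
  where
  open Layers closed connected
  open ≡-Reasoning

  sorted-edges : Linked _≤_ (seqS G N)
  sorted-edges = map-linked (edgesToNext G N) (λ _ v∈ u<v → edgesToNext-mono u<v v∈)
                            (layer-all N) (AllPairs⇒Linked (layer-sorted N))

  last-edges : last (seqS G N) ≡ just (layerSize G (suc N))
  last-edges with last-layer ltDiam
  ... | m , last≡m , m∈ , maximal = begin
    last (map (edgesToNext G N) (layer G N))      ≡⟨ last-map (edgesToNext G N) (layer G N) ⟩
    Maybe.map (edgesToNext G N) (last (layer G N)) ≡⟨ cong (Maybe.map _) last≡m ⟩
    just (edgesToNext G N m)                      ≡⟨ cong just (edgesToNext-max m∈ maximal) ⟩
    just (layerSize G (suc N))                    ∎
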